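{- Let $n\ge 2$. Every arithmetical $r$-structure $\mathbf{r}$ on the cycle $\mathcal{C}_n$ satisfies $\mathbf{r}(1)>0$, i.e. some entry of $\mathbf{r}$ equals $1$.
   Context: For $n\ge 3$, $\mathcal{C}_n$ is the cycle graph with vertices $1,\dots,n$ and edges $\{i,i+1\}$ (indices mod $n$); $\mathcal{C}_2$ is two vertices joined by two parallel edges (adjacency matrix $\begin{pmatrix}0&2\\2&0\end{pmatrix}$). An arithmetical structure on $\mathcal{C}_n$ is a pair $(\mathbf{d},\mathbf{r})$ of positive integer vectors in $\mathbb{Z}^n$ with $\mathbf{r}$ primitive (gcd of entries $1$) and $(\operatorname{diag}(\mathbf{d})-A)\mathbf{r}=\mathbf{0}$, $A$ the adjacency matrix; equivalently $r_{i-1}+r_{i+1}=d_ir_i$ for all $i$ with indices mod $n$. $\mathbf{r}$ is called an arithmetical $r$-structure. $\mathbf{r}(1)=\#\{i:r_i=1\}$. -}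

module Defs where

open import Data.Nat using (ℕ; zero; suc; _+_; _*_; _<_)
open import Data.Nat.GCD using (gcd)
open import Data.Fin using (Fin; toℕ; fromℕ<)
open import Data.Nat.DivMod using (_%_; m%n<n)
open import Data.Product using (_×_; ∃)
open import Relation.Binary.PropositionalEquality using (_≡_)

-- Cycle vertices are Fin n (vertex i+1 of the paper is index i).
-- Successor / predecessor modulo n (n ≥ 1).
nextC : ∀ {n} → Fin (suc n) → Fin (suc n)
nextC {n} i = fromℕ< (m%n<n (suc (toℕ i)) (suc n))

prevC : ∀ {n} → Fin (suc n) → Fin (suc n)
prevC {n} i = fromℕ< (m%n<n (toℕ i + n) (suc n))

gcdAll : ∀ {n} → (Fin n → ℕ) → ℕ
gcdAll {zero} r = 0
gcdAll {suc n} r = gcd (r Fin.zero) (gcdAll (λ i → r (Fin.suc i)))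

Positive : ∀ {n} → (Fin n → ℕ) → Set
Positive {n} v = ∀ i → 0 < v i

-- For n = 2 this is
-- 2 r_{other} = d_i r_i, i.e. the double-edge C_2 of the paper.
IsArithStructure : ∀ {n} → (Fin (suc n) → ℕ) → (Fin (suc n) → ℕ) → Set
IsArithStructure d r =
  Positive d × Positive r × gcdAll r ≡ 1 ×
  (∀ i → r (prevC i) + r (nextC i) ≡ d i * r i)

IsArithR : ∀ {n} → (Fin (suc n) → ℕ) → Set
IsArithR {n} r = ∃ λ (d : Fin (suc n) → ℕ) → IsArithStructure d r

-- Let M = r_j be a largest entry.  If r is constant, primitivity forces M = 1.
-- Otherwise some largest entry has a strictly smaller neighbour; as r_j divides
-- r_{j-1} + r_{j+1}, which lies strictly between 0 and 2M, we get
-- r_j = r_{j-1} + r_{j+1}.  Deleting vertex j then leaves an arithmetical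
-- r-structure on the cycle of length n - 1 with the remaining entries, so we
-- conclude by induction on n, down to the one-vertex cycle where r = (1).
module Submission where

open import Defs
open import Data.Nat using (ℕ; zero; suc; _+_; _*_; _≤_; _<_; s≤s; NonZero; _≟_)
open import Data.Nat.Properties
open import Algebra.Properties.CommutativeSemigroup +-commutativeSemigroup
  using (x∙yz≈y∙xz; x∙yz≈xz∙y; xy∙z≈y∙xz; xy∙z≈xz∙y)
open import Data.Nat.Divisibility
open import Data.Nat.DivMod
open import Data.Nat.GCD using (gcd-greatest)
open import Data.Fin using (Fin; toℕ)
open import Data.Fin.Properties using (fromℕ<-cong; fromℕ<-toℕ; toℕ<n; toℕ-fromℕ<)
open import Data.List using (upTo)
open import Data.List.Extrema.Nat using (argmax; f[xs]≤f[argmax])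
open import Data.List.Membership.Propositional.Properties using (∈-upTo⁺)
open import Data.List.Relation.Unary.All as All using ()
open import Data.Product using (∃; _,_; _×_)
open import Data.Sum using (_⊎_; inj₁; inj₂)
open import Data.Empty using (⊥-elim)
open import Relation.Nullary using (yes; no)
open import Relation.Binary.PropositionalEquality

Periodic : ℕ → (ℕ → ℕ) → Set
Periodic n f = ∀ k → f (k + n) ≡ f k

module _ {n : ℕ} {f : ℕ → ℕ} (per : Periodic n f) where

  periodic-+* : ∀ k q → f (k + q * n) ≡ f k
  periodic-+* k zero = cong f (+-identityʳ k)
  periodic-+* k (suc q) = begin
    f (k + (n + q * n)) ≡⟨ cong f (x∙yz≈xz∙y k n (q * n)) ⟩
    f (k + q * n + n)   ≡⟨ per (k + q * n) ⟩
    f (k + q * n)       ≡⟨ periodic-+* k q ⟩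
    f k                 ∎
    where open ≡-Reasoning

  module _ .{{_ : NonZero n}} where

    periodic-+% : ∀ a k → f (a + k) ≡ f (a + k % n)
    periodic-+% a k = begin
      f (a + k)                   ≡⟨ cong (λ x → f (a + x)) (m≡m%n+[m/n]*n k n) ⟩
      f (a + (k % n + k / n * n)) ≡⟨ cong f (+-assoc a (k % n) (k / n * n)) ⟨
      f (a + k % n + k / n * n)   ≡⟨ periodic-+* (a + k % n) (k / n) ⟩
      f (a + k % n)               ∎
      where open ≡-Reasoning

    periodic-% : ∀ k → f k ≡ f (k % n)
    periodic-% = periodic-+% 0

    periodic-all : {P : ℕ → Set} → (∀ u → u < n → P (f u)) → ∀ k → P (f k)
    periodic-all {P} P-period k = subst P (sym (periodic-% k)) (P-period (k % n) (m%n<n k n))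

    periodic-neighbours : (∀ t → t < n → f (suc t) ∣ f t + f (suc (suc t))) →
                          ∀ k → f (suc k) ∣ f k + f (suc (suc k))
    periodic-neighbours local k =
      subst₂ _∣_ (sym (periodic-+% 1 k))
                 (sym (cong₂ _+_ (periodic-% k) (periodic-+% 2 k)))
                 (local (k % n) (m%n<n k n))

-- The r-vector of an arithmetical structure on C_n, read as an n-periodic
-- sequence; d_i = (r_{i-1} + r_{i+1}) / r_i is determined by r.
record IsCyclicArith (n : ℕ) (f : ℕ → ℕ) : Set where
  field
    periodic         : Periodic n f
    positive         : ∀ k → 0 < f k
    neighbours       : ∀ k → f (suc k) ∣ f k + f (suc (suc k))
    common-divisor≡1 : ∀ c → (∀ k → c ∣ f k) → c ≡ 1
open IsCyclicArith

rotate : ∀ {n f} → IsCyclicArith (suc n) f → ∀ s → IsCyclicArith (suc n) (λ k → f (k + s))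
rotate {n} {f} S s = record
  { periodic         = λ k → trans (cong f (xy∙z≈xz∙y k (suc n) s)) (periodic S (k + s))
  ; positive         = λ k → positive S (k + s)
  ; neighbours       = λ k → neighbours S (k + s)
  ; common-divisor≡1 = λ c c∣ → common-divisor≡1 S c λ k →
      subst (c ∣_) (trans (cong f (shift k)) (periodic-+* (periodic S) k s)) (c∣ (k + s * n))
  }
  where
  shift : ∀ k → k + s * n + s ≡ k + s * suc n
  shift k = trans (sym (x∙yz≈xz∙y k s (s * n))) (cong (k +_) (sym (*-suc s n)))

m∣n⇒0<n⇒n<m+m⇒n≡m : ∀ {m n} → m ∣ n → 0 < n → n < m + m → n ≡ m
m∣n⇒0<n⇒n<m+m⇒n≡m (divides zero refl) () _
m∣n⇒0<n⇒n<m+m⇒n≡m {m} (divides (suc zero) refl) _ _ = +-identityʳ m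
m∣n⇒0<n⇒n<m+m⇒n≡m {m} (divides (suc (suc q)) refl) _ n<2m =
  ⊥-elim (<⇒≱ n<2m (+-monoʳ-≤ m (m≤m+n m (q * m))))

peak≡sum : ∀ {n f} → IsCyclicArith (suc (suc n)) f →
           f (suc n) ≤ f 0 → f 1 < f 0 → f 0 ≡ f (suc n) + f 1
peak≡sum {n} {f} S left≤ right< = sym (m∣n⇒0<n⇒n<m+m⇒n≡m f0∣sum
  (<-≤-trans (positive S 1) (m≤n+m (f 1) (f (suc n))))
  (+-mono-≤-< left≤ right<))
  where
  f0∣sum : f 0 ∣ f (suc n) + f 1
  f0∣sum = subst₂ (λ x y → x ∣ f (suc n) + y) (periodic S 0) (periodic S 1)
                  (neighbours S (suc n))

-- Deleting vertex 0 keeps the entries h 1, …, h (suc n), repeated periodically.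
module _ {n : ℕ} {h : ℕ → ℕ} (S : IsCyclicArith (suc (suc n)) h)
         (h0≡sum : h 0 ≡ h (suc n) + h 1) where

  private
    g : ℕ → ℕ
    g k = h (suc (k % suc n))

    g-periodic : Periodic (suc n) g
    g-periodic k = cong (λ x → h (suc x)) ([m+n]%n≡m%n k (suc n))

    g-below : ∀ {u} → u < suc n → g u ≡ h (suc u)
    g-below u<m = cong (λ x → h (suc x)) (m<n⇒m%n≡m u<m)

    ∣-cancel : ∀ {d x} → d ∣ d + x → d ∣ x
    ∣-cancel d∣d+x = ∣m+n∣m⇒∣n d∣d+x ∣-refl

    wrap-left : g (suc n) ∣ g n + g (suc (suc n))
    wrap-left = subst₂ (λ x y → x ∣ g n + y) (sym (g-periodic 0)) (sym (g-periodic 1))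
                       (subst (λ x → h 1 ∣ x + g 1) (sym (g-below ≤-refl)) (around n refl))
      where
      -- For n = 0 the two neighbours of the deleted vertex coincide.
      around : ∀ m → suc m ≡ suc n → h 1 ∣ h (suc n) + h (suc (1 % suc m))
      around zero refl = ∣m∣n⇒∣m+n ∣-refl ∣-refl
      around (suc m) refl = ∣-cancel (subst (h 1 ∣_)
        (trans (cong (_+ h 2) h0≡sum) (xy∙z≈y∙xz (h (suc n)) (h 1) (h 2)))
        (neighbours S 0))

    wrap-right : ∀ t → suc t ≡ n → g (suc t) ∣ g t + g (suc (suc t))
    wrap-right t refl =
      subst₂ _∣_
             (sym (g-below ≤-refl))
             (sym (cong₂ _+_ (g-below (s≤s (n≤1+n t))) (g-periodic 0)))
             (∣-cancel (subst (h (suc n) ∣_)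
               (trans (cong (h n +_) (trans (periodic S 0) h0≡sum))
                      (x∙yz≈y∙xz (h n) (h (suc n)) (h 1)))
               (neighbours S n)))

    g-neighbours : ∀ t → t < suc n → g (suc t) ∣ g t + g (suc (suc t))
    g-neighbours t t<m with m≤n⇒m<n∨m≡n (≤-pred t<m)
    ... | inj₂ refl = wrap-left
    ... | inj₁ t<n with m≤n⇒m<n∨m≡n t<n
    ...   | inj₂ st≡n = wrap-right t st≡n
    ...   | inj₁ st<n =
      subst₂ _∣_
             (sym (g-below (s≤s t<n)))
             (sym (cong₂ _+_ (g-below (<⇒≤ (s≤s t<n))) (g-below (s≤s st<n))))
             (neighbours S (suc t))

    h-divisors : ∀ c → (∀ k → c ∣ g k) → ∀ u → u < suc (suc n) → c ∣ h u
    h-divisors c c∣g zero _ = subst (c ∣_) (sym h0≡sum)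
      (∣m∣n⇒∣m+n (subst (c ∣_) (g-below ≤-refl) (c∣g n)) (c∣g 0))
    h-divisors c c∣g (suc u) u<N = subst (c ∣_) (g-below (≤-pred u<N)) (c∣g u)

  contract : IsCyclicArith (suc n) (λ k → h (suc (k % suc n)))
  contract = record
    { periodic         = g-periodic
    ; positive         = λ k → positive S _
    ; neighbours       = periodic-neighbours g-periodic g-neighbours
    ; common-divisor≡1 = λ c c∣g →
        common-divisor≡1 S c (periodic-all (periodic S) {c ∣_} (h-divisors c c∣g))
    }

max-attained : ∀ {n f} → IsCyclicArith (suc n) f → ∃ λ i → ∀ k → f k ≤ f i
max-attained {n} {f} S = i , periodic-all (periodic S) {_≤ f i}
  (λ u u<N → All.lookup (f[xs]≤f[argmax] {f = f} 0 (upTo (suc n))) (∈-upTo⁺ u<N))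
  where
  i : ℕ
  i = argmax f 0 (upTo (suc n))

plateau⊎descent : ∀ {f : ℕ → ℕ} → (∀ k → f k ≤ f 0) → ∀ t →
                  (∀ s → s ≤ t → f s ≡ f 0) ⊎ ∃ λ j → f j ≡ f 0 × f (suc j) < f 0
plateau⊎descent {f} f≤f0 zero = inj₁ λ { zero _ → refl }
plateau⊎descent {f} f≤f0 (suc t) with plateau⊎descent {f} f≤f0 t
... | inj₂ descent = inj₂ descent
... | inj₁ flat with f (suc t) ≟ f 0
...   | no ≢f0 = inj₂ (t , flat t ≤-refl , ≤∧≢⇒< (f≤f0 (suc t)) ≢f0)
...   | yes ≡f0 = inj₁ flat′
  where
  flat′ : ∀ s → s ≤ suc t → f s ≡ f 0
  flat′ s s≤ with m≤n⇒m<n∨m≡n s≤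
  ... | inj₁ s< = flat s (≤-pred s<)
  ... | inj₂ refl = ≡f0

plateau⇒≡1 : ∀ {n f} → IsCyclicArith (suc n) f → (∀ s → s ≤ n → f s ≡ f 0) → f 0 ≡ 1
plateau⇒≡1 {f = f} S flat = common-divisor≡1 S (f 0) (periodic-all (periodic S) {f 0 ∣_}
  λ u u<N → ∣-reflexive (sym (flat u (≤-pred u<N))))

contract-descent : ∀ {n h j} → IsCyclicArith (suc (suc n)) h → (∀ k → h k ≤ h 0) →
                   h j ≡ h 0 → h (suc j) < h 0 →
                   IsCyclicArith (suc n) (λ k → h (suc (k % suc n) + j))
contract-descent {n} {h} {j} S h≤h0 peak descent = contract S′ (peak≡sum S′
  (subst (h (suc n + j) ≤_) (sym peak) (h≤h0 (suc n + j)))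
  (subst (h (suc j) <_) (sym peak) descent))
  where
  S′ = rotate S j

unit-entry : ∀ n {f} → IsCyclicArith (suc n) f → ∃ λ k → f k ≡ 1
unit-entry zero S = 0 , plateau⇒≡1 S λ { zero _ → refl }
unit-entry (suc n) {f} S = from-max (max-attained S)
  where
  from-max : ∃ (λ i → ∀ k → f k ≤ f i) → ∃ λ k → f k ≡ 1
  from-max (i , f≤fi) with plateau⊎descent {λ k → f (k + i)} (λ k → f≤fi (k + i)) (suc n)
  ... | inj₁ flat = i , plateau⇒≡1 (rotate S i) flat
  ... | inj₂ (j , peak , descent) =
    let k , e = unit-entry n (contract-descent (rotate S i) (λ k → f≤fi (k + i)) peak descent)
    in  suc (k % suc n) + j + i , e

∣gcdAll : ∀ {m} (r : Fin m → ℕ) {c} → (∀ i → c ∣ r i) → c ∣ gcdAll r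
∣gcdAll {zero} r c∣ = _ ∣0
∣gcdAll {suc m} r c∣ =
  gcd-greatest (c∣ Fin.zero) (∣gcdAll (λ i → r (Fin.suc i)) (λ i → c∣ (Fin.suc i)))

unfold : ∀ {n} → (Fin (suc n) → ℕ) → ℕ → ℕ
unfold {n} r k = r (k mod suc n)

module _ {n : ℕ} where

  private
    N = suc n

    mod-cong : ∀ a b → a % N ≡ b % N → a mod N ≡ b mod N
    mod-cong a b e = fromℕ<-cong _ _ e _ _

    mod-toℕ : ∀ i → toℕ i mod N ≡ i
    mod-toℕ i = trans (fromℕ<-cong (toℕ i % N) (toℕ i) (m<n⇒m%n≡m (toℕ<n i)) _ (toℕ<n i))
                      (fromℕ<-toℕ i (toℕ<n i))

    %-periodic : Periodic N (_% N)
    %-periodic k = [m+n]%n≡m%n k N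

    prevC-mod : ∀ k → prevC (suc k mod N) ≡ k mod N
    prevC-mod k = mod-cong (toℕ (suc k mod N) + n) k (begin
      (toℕ (suc k mod N) + n) % N ≡⟨ cong (λ x → (x + n) % N) (toℕ-fromℕ< (m%n<n (suc k) N)) ⟩
      (suc k % N + n) % N         ≡⟨ cong (_% N) (+-comm (suc k % N) n) ⟩
      (n + suc k % N) % N         ≡⟨ periodic-+% %-periodic n (suc k) ⟨
      (n + suc k) % N             ≡⟨ cong (_% N) (trans (+-comm n (suc k)) (sym (+-suc k n))) ⟩
      (k + N) % N                 ≡⟨ %-periodic k ⟩
      k % N                       ∎)
      where open ≡-Reasoning

    nextC-mod : ∀ k → nextC (suc k mod N) ≡ suc (suc k) mod N
    nextC-mod k = mod-cong (1 + toℕ (suc k mod N)) (suc (suc k)) (begin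
      (1 + toℕ (suc k mod N)) % N ≡⟨ cong (λ x → (1 + x) % N) (toℕ-fromℕ< (m%n<n (suc k) N)) ⟩
      (1 + suc k % N) % N         ≡⟨ periodic-+% %-periodic 1 (suc k) ⟨
      (1 + suc k) % N             ∎)
      where open ≡-Reasoning

  unfold-cyclicArith : ∀ {d r : Fin N → ℕ} → IsArithStructure d r → IsCyclicArith N (unfold r)
  unfold-cyclicArith {d} {r} (_ , r-pos , gcd≡1 , balance) = record
    { periodic         = λ k → cong r (mod-cong (k + N) k (%-periodic k))
    ; positive         = λ k → r-pos _
    ; neighbours       = λ k → divides (d (suc k mod N))
        (subst₂ (λ x y → r x + r y ≡ d (suc k mod N) * r (suc k mod N))
                (prevC-mod k) (nextC-mod k) (balance (suc k mod N)))
    ; common-divisor≡1 = λ c c∣ → ∣1⇒≡1 (subst (c ∣_) gcd≡1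
        (∣gcdAll r λ i → subst (c ∣_) (cong r (mod-toℕ i)) (c∣ (toℕ i))))
    }

corollary3p5 : (m : ℕ) → (r : Fin (suc (suc m)) → ℕ) →
    IsArithR r → ∃ λ (i : Fin (suc (suc m))) → r i ≡ 1
corollary3p5 m r (d , arith) =
  let k , rk≡1 = unit-entry (suc m) (unfold-cyclicArith arith) in k mod suc (suc m) , rk≡1
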